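{- A connected graph $G$ with $n\ge5$ vertices is $1$-metamour-regular if and only if $\overline{G}$ equals the metamour graph of $G$ and this graph is $1$-regular.
   Context: All graphs are finite and simple; isomorphic graphs are regarded as equal. A vertex $v$ is a metamour of a vertex $w$ in $G$ if their distance in $G$ equals $2$. The metamour graph of $G$ is the graph on $V(G)$ with an edge between $v$ and $w$ whenever $v$ is a metamour of $w$. $G$ is $1$-metamour-regular if every vertex has exactly one metamour. $\overline{G}$ is the complement of $G$. -}

module Defs where

open import Data.Nat using (ℕ; zero; suc; _<_)
open import Data.Fin using (Fin)
open import Data.Bool using (Bool; true; false)
open import Data.Product using (Σ; _×_; ∃)
open import Relation.Binary.PropositionalEquality using (_≡_; _≢_)
open import Relation.Nullary using (¬_)
open import Function.Bundles using (_⇔_)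

record Graph (n : ℕ) : Set where
  field
    edge  : Fin n → Fin n → Bool
    irrefl : ∀ v → edge v v ≡ false
    sym   : ∀ v w → edge v w ≡ edge w v

module _ {n : ℕ} (G : Graph n) where
  open Graph G

  Adj : Fin n → Fin n → Set
  Adj v w = edge v w ≡ true

  data Walk : Fin n → Fin n → ℕ → Set where
    here : ∀ {v} → Walk v v zero
    step : ∀ {u v w k} → Adj u v → Walk v w k → Walk u w (suc k)

  Dist : Fin n → Fin n → ℕ → Set
  Dist v w d = Walk v w d × (∀ k → k < d → ¬ Walk v w k)

  Connected : Set
  Connected = ∀ v w → ∃ λ k → Walk v w k

  Metamour : Fin n → Fin n → Set
  Metamour v w = Dist v w 2

  ComplAdj : Fin n → Fin n → Set
  ComplAdj v w = v ≢ w × ¬ Adj v w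

OneRegular : {n : ℕ} → (Fin n → Fin n → Set) → Set
OneRegular {n} R = ∀ v → Σ (Fin n) λ w → R v w × (∀ u → R v u → u ≡ w)

OneMetamourRegular : {n : ℕ} → Graph n → Set
OneMetamourRegular G = OneRegular (Metamour G)

ComplementIsMetamourGraph : {n : ℕ} → Graph n → Set
ComplementIsMetamourGraph {n} G = ∀ (v w : Fin n) → ComplAdj G v w ⇔ Metamour G v w

{-# OPTIONS --safe #-}
-- Metamours are exactly the non-adjacent vertices at distance 2, so everything hinges on the
-- diameter being at most 2.  If it were not, a shortest path v x y z would exist, and since the
-- metamour relation is a perfect matching pairing v with y and x with z, every further neighbour
-- would create a second metamour for one of them: the set {v, x, y, z} is closed under
-- adjacency, hence is the whole connected graph, contradicting n ≥ 5.
module Submission where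

open import Defs
open import Data.Nat using (ℕ; _≤_; _<_; s≤s; z≤n)
open import Data.Nat.Properties using (≤⇒≯)
open import Data.Product using (_×_; _,_; proj₁; proj₂; ∃)
open import Data.Sum using (_⊎_; inj₁; inj₂)
open import Data.Bool using (true) renaming (_≟_ to _≟ᵇ_)
open import Data.Fin using (Fin; zero; suc; #_) renaming (_≟_ to _≟ᶠ_)
open import Data.Fin.Properties using (any?; injective⇒≤)
open import Data.Empty using (⊥; ⊥-elim)
open import Function.Bundles using (_⇔_; mk⇔)
open import Relation.Nullary using (¬_; Dec; yes; no; _×-dec_)
open import Relation.Binary.PropositionalEquality

surjective⇒≤ : ∀ {k n} (f : Fin k → Fin n) → (∀ w → ∃ λ i → f i ≡ w) → n ≤ k
surjective⇒≤ {k} {n} f f-onto = injective⇒≤ {f = section} section-injective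
  where
  section : Fin n → Fin k
  section w = proj₁ (f-onto w)

  section-injective : ∀ {u w} → section u ≡ section w → u ≡ w
  section-injective {u} {w} eq = begin
    u                  ≡⟨ sym (proj₂ (f-onto u)) ⟩
    f (section u)      ≡⟨ cong f eq ⟩
    f (section w)      ≡⟨ proj₂ (f-onto w) ⟩
    w                  ∎
    where open ≡-Reasoning

OneRegular-unique : ∀ {n} {R : Fin n → Fin n → Set} → OneRegular R →
                    ∀ {v u w} → R v u → R v w → u ≡ w
OneRegular-unique reg {v} {u} {w} Rvu Rvw with reg v
... | _ , _ , only = trans (only u Rvu) (sym (only w Rvw))

module GraphProperties {n : ℕ} (G : Graph n) where
  open Graph G using (edge; irrefl) renaming (sym to edge-sym)

  Adj-sym : ∀ {u v} → Adj G u v → Adj G v u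
  Adj-sym {u} {v} uv = trans (edge-sym v u) uv

  Adj-irrefl : ∀ {v} → ¬ Adj G v v
  Adj-irrefl {v} vv with trans (sym (irrefl v)) vv
  ... | ()

  Adj? : ∀ u v → Dec (Adj G u v)
  Adj? u v = edge u v ≟ᵇ true

  Closed : (Fin n → Set) → Set
  Closed P = ∀ {u v} → P u → Adj G u v → P v

  Walk-preserves : ∀ {P} → Closed P → ∀ {u v k} → Walk G u v k → P u → P v
  Walk-preserves closed here         Pu = Pu
  Walk-preserves closed (step uv vw) Pu = Walk-preserves closed vw (closed Pu uv)

  connected-closed : Connected G → ∀ {P} → Closed P → ∀ {v} → P v → ∀ w → P w
  connected-closed connected closed {v} Pv w =
    Walk-preserves closed (proj₂ (connected v w)) Pv

  metamour : ∀ {u v w} → Adj G u v → Adj G v w → u ≢ w → ¬ Adj G u w → Metamour G u w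
  metamour uv vw u≢w ¬uw = step uv (step vw here) , shorter
    where
    shorter : ∀ k → k < 2 → ¬ Walk G _ _ k
    shorter 0 _                here           = u≢w refl
    shorter 1 _                (step uw here) = ¬uw uw
    shorter _ (s≤s (s≤s ()))   (step _ (step _ _))

  Metamour⇒≢ : ∀ {u w} → Metamour G u w → u ≢ w
  Metamour⇒≢ (_ , shorter) refl = shorter 0 (s≤s z≤n) here

  Metamour⇒¬Adj : ∀ {u w} → Metamour G u w → ¬ Adj G u w
  Metamour⇒¬Adj (_ , shorter) uw = shorter 1 (s≤s (s≤s z≤n)) (step uw here)

  Metamour⇒ComplAdj : ∀ {u w} → Metamour G u w → ComplAdj G u w
  Metamour⇒ComplAdj m = Metamour⇒≢ m , Metamour⇒¬Adj m

  Metamour-sym : ∀ {u w} → Metamour G u w → Metamour G w u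
  Metamour-sym m@(step uv (step vw here) , _) =
    metamour (Adj-sym vw) (Adj-sym uv) (λ w≡u → Metamour⇒≢ m (sym w≡u))
             (λ wu → Metamour⇒¬Adj m (Adj-sym wu))

module OneMetamourRegularGraph {n : ℕ} (G : Graph n) (regular : OneMetamourRegular G) where
  open GraphProperties G

  metamour-unique : ∀ {v u w} → Metamour G v u → Metamour G v w → u ≡ w
  metamour-unique = OneRegular-unique regular

  -- The hypotheses say that v x y z is a shortest path, i.e. that v and z are at distance 3.
  module DistanceThree {v x y z : Fin n} (vx : Adj G v x) (xy : Adj G x y) (yz : Adj G y z)
                       (¬vz : ¬ Adj G v z)
                       (no-common : ¬ ∃ λ c → Adj G v c × Adj G c z) where

    ¬xz : ¬ Adj G x z
    ¬xz xz = no-common (x , vx , xz)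

    Mvy : Metamour G v y
    Mvy = metamour vx xy (λ { refl → ¬vz yz }) (λ vy → no-common (y , vy , yz))

    Mxz : Metamour G x z
    Mxz = metamour xy yz (λ { refl → ¬vz vx }) ¬xz

    Myv : Metamour G y v
    Myv = Metamour-sym Mvy

    Mzx : Metamour G z x
    Mzx = Metamour-sym Mxz

    neighbour-of-v : ∀ {s} → Adj G v s → s ≡ x
    neighbour-of-v {s} vs with s ≟ᶠ x | Adj? s x | Adj? s y
    ... | yes s≡x | _      | _      = s≡x
    ... | no s≢x  | no ¬sx | _      =
      ⊥-elim (¬vz (subst (Adj G v) (metamour-unique Mxs Mxz) vs))
      where
      Mxs : Metamour G x s
      Mxs = metamour (Adj-sym vx) vs (λ x≡s → s≢x (sym x≡s)) (λ xs → ¬sx (Adj-sym xs))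
    ... | no s≢x  | yes sx | yes sy =
      ⊥-elim (s≢x (metamour-unique Mzs Mzx))
      where
      Mzs : Metamour G z s
      Mzs = metamour (Adj-sym yz) (Adj-sym sy) (λ { refl → ¬vz vs }) (λ zs → no-common (s , vs , Adj-sym zs))
    ... | no s≢x  | yes sx | no ¬sy =
      ⊥-elim (Adj-irrefl (subst (Adj G v) (metamour-unique Mys Myv) vs))
      where
      Mys : Metamour G y s
      Mys = metamour (Adj-sym xy) (Adj-sym sx) (λ { refl → Metamour⇒¬Adj Mvy vs }) (λ ys → ¬sy (Adj-sym ys))

    no-common-neighbour-of-y-z : ∀ {s} → Adj G s y → Adj G s z → ⊥
    no-common-neighbour-of-y-z {s} sy sz with Adj? v s | Adj? s x
    ... | yes vs | _      = no-common (s , vs , sz)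
    ... | no ¬vs | yes sx =
      Adj-irrefl (subst (λ t → Adj G t y) (metamour-unique Mvs Mvy) sy)
      where
      Mvs : Metamour G v s
      Mvs = metamour vx (Adj-sym sx) (λ { refl → Metamour⇒¬Adj Mvy sy }) ¬vs
    ... | no ¬vs | no ¬sx =
      Adj-irrefl (subst (λ t → Adj G t z) (metamour-unique Mxs Mxz) sz)
      where
      Mxs : Metamour G x s
      Mxs = metamour xy (Adj-sym sy) (λ { refl → ¬xz sz }) (λ xs → ¬sx (Adj-sym xs))

    path : Fin 4 → Fin n
    path zero                = v
    path (suc zero)          = x
    path (suc (suc zero))    = y
    path (suc (suc (suc _))) = z

    OnPath : Fin n → Set
    OnPath s = ∃ λ i → path i ≡ s

    OnPath-closed : Closed OnPath
    OnPath-closed (zero , refl) vs = # 1 , sym (neighbour-of-v vs)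
    OnPath-closed {v = s} (suc zero , refl) xs with s ≟ᶠ v | Adj? v s
    ... | yes s≡v | _      = # 0 , sym s≡v
    ... | no _    | yes vs = # 1 , sym (neighbour-of-v vs)
    ... | no s≢v  | no ¬vs = # 2 , metamour-unique Mvy (metamour vx xs (λ v≡s → s≢v (sym v≡s)) ¬vs)
    OnPath-closed {v = s} (suc (suc zero) , refl) ys with Adj? v s | s ≟ᶠ z | Adj? s z
    ... | yes vs | _       | _      = # 1 , sym (neighbour-of-v vs)
    ... | no _   | yes s≡z | _      = # 3 , sym s≡z
    ... | no _   | no _    | yes sz = ⊥-elim (no-common-neighbour-of-y-z (Adj-sym ys) sz)
    ... | no _   | no s≢z  | no ¬sz =
      # 1 , metamour-unique Mzx (metamour (Adj-sym yz) ys (λ z≡s → s≢z (sym z≡s)) (λ zs → ¬sz (Adj-sym zs)))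
    OnPath-closed {v = s} (suc (suc (suc zero)) , refl) zs with s ≟ᶠ y | Adj? s y
    ... | yes s≡y | _      = # 2 , sym s≡y
    ... | no _    | yes sy = ⊥-elim (no-common-neighbour-of-y-z sy (Adj-sym zs))
    ... | no s≢y  | no ¬sy =
      # 0 , metamour-unique Myv (metamour yz zs (λ y≡s → s≢y (sym y≡s)) (λ ys → ¬sy (Adj-sym ys)))

    at-most-four-vertices : Connected G → n ≤ 4
    at-most-four-vertices connected =
      surjective⇒≤ path (connected-closed connected OnPath-closed (# 0 , refl))

  module DiameterTwo (five≤n : 5 ≤ n) (connected : Connected G) (v : Fin n) where

    y : Fin n
    y = proj₁ (regular v)

    Mvy : Metamour G v y
    Mvy = proj₁ (proj₂ (regular v))

    WithinTwo : Fin n → Set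
    WithinTwo s = s ≡ v ⊎ Adj G v s ⊎ s ≡ y

    neighbour-step : ∀ {t s} → Adj G v t → Adj G t s → WithinTwo s
    neighbour-step {s = s} vt ts with s ≟ᶠ v | Adj? v s
    ... | yes s≡v | _      = inj₁ s≡v
    ... | no _    | yes vs = inj₂ (inj₁ vs)
    ... | no s≢v  | no ¬vs =
      inj₂ (inj₂ (metamour-unique (metamour vt ts (λ v≡s → s≢v (sym v≡s)) ¬vs) Mvy))

    WithinTwo-closed : Closed WithinTwo
    WithinTwo-closed (inj₁ refl)        vs = inj₂ (inj₁ vs)
    WithinTwo-closed (inj₂ (inj₁ vt))   ts = neighbour-step vt ts
    WithinTwo-closed {v = s} (inj₂ (inj₂ refl)) ys
      with Adj? v s | any? (λ c → Adj? v c ×-dec Adj? c s)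
    ... | yes vs | _                 = inj₂ (inj₁ vs)
    ... | no _   | yes (c , vc , cs) = neighbour-step vc cs
    ... | no ¬vs | no no-common with Mvy
    ... | step vx (step xy here) , _ =
      ⊥-elim (≤⇒≯ (DistanceThree.at-most-four-vertices vx xy ys ¬vs no-common connected) five≤n)

    ComplAdj⇒Metamour : ∀ {w} → ComplAdj G v w → Metamour G v w
    ComplAdj⇒Metamour {w} (v≢w , ¬vw) with connected-closed connected WithinTwo-closed (inj₁ refl) w
    ... | inj₁ w≡v        = ⊥-elim (v≢w (sym w≡v))
    ... | inj₂ (inj₁ vw)  = ⊥-elim (¬vw vw)
    ... | inj₂ (inj₂ refl) = Mvy

corollary3p6 : (n : ℕ) → 5 ≤ n → (G : Graph n) → Connected G →
    OneMetamourRegular G ⇔ (ComplementIsMetamourGraph G × OneRegular (Metamour G))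
corollary3p6 n five≤n G connected = mk⇔ (λ regular → complement-is-metamour regular , regular) proj₂
  where
  open GraphProperties G using (Metamour⇒ComplAdj)

  complement-is-metamour : OneMetamourRegular G → ComplementIsMetamourGraph G
  complement-is-metamour regular v w = mk⇔ ComplAdj⇒Metamour Metamour⇒ComplAdj
    where open OneMetamourRegularGraph.DiameterTwo G regular five≤n connected v
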